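{- Let $p=6q+1$ be a prime (with $q$ a positive integer), and for real $a$ let $(a)_p=a(a+1)\cdots(a+p-1)$. Then $$4^p\left(\tfrac16\right)_p\equiv \left(\tfrac23\right)_p\pmod{p^3}.$$
   Context: Both sides are rational numbers whose denominators are products of powers of $2$ and $3$, hence prime to $p$. For such rationals $x,y$, $x\equiv y\pmod{p^k}$ means that $x-y$, in lowest terms, has numerator divisible by $p^k$. -}

module Defs where

open import Data.Nat using (ℕ; zero; suc)
open import Data.Nat.Divisibility using (_∣_)
open import Data.Integer using (∣_∣; +_)
open import Data.Rational using (ℚ; _+_; _*_; _-_; _/_; 1ℚ; ↥_)

ℕtoℚ : ℕ → ℚ
ℕtoℚ m = (+ m) / 1

poch : ℚ → ℕ → ℚ
poch a zero    = 1ℚ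
poch a (suc n) = poch a n * (a + ℕtoℚ n)

-- x ≡ y (mod m) for rationals: the numerator of x - y in lowest terms
-- (ℚ from Data.Rational is always normalised) is divisible by m.
_≡ℚ_[mod_] : ℚ → ℚ → ℕ → Set
x ≡ℚ y [mod m ] = m ∣ ∣ ↥ (x - y) ∣

module Submission where

open import Defs
open import Relation.Binary.PropositionalEquality
open import Relation.Nullary using (¬_)
open import Function using (_∘_)
open import Data.Empty using (⊥-elim)
open import Data.Product using (_,_)
open import Data.Sum using (_⊎_; inj₁; inj₂)
open import Data.Nat using (ℕ; zero; suc; NonZero; nonTrivial⇒n>1; _+_; _*_; _^_; _≤_; _<_; z≤n; s≤s)
import Data.Nat.Properties as ℕ
import Data.Nat.Tactic.RingSolver as ℕS
open import Data.Nat.DivMod using (_%_; [m+kn]%n≡m%n)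
open import Data.Nat.Divisibility using (_∣_; divides; ∣1⇒≡1; ∣-trans; ∣m⇒∣m*n)
open import Data.Nat.Coprimality as ℕC using (Coprime; coprime-divisor; 1-coprimeTo)
open import Data.Nat.Primality using (Prime; euclidsLemma; prime⇒nonTrivial; prime⇒nonZero; prime⇒irreducible)
open import Data.Integer using (ℤ; +_; -[1+_]; ∣_∣) renaming (_+_ to _+ᶻ_; _*_ to _*ᶻ_; _-_ to _-ᶻ_; -_ to -ᶻ_)
import Data.Integer.Properties as ℤP
open import Data.Integer.Divisibility.Signed as ℤ∣ using (divides) renaming (_∣_ to _∣ᶻ_)
open import Data.Integer.Tactic.RingSolver using (solve-∀)
open import Data.Rational using (ℚ; mkℚ; _/_; ↥_; ↧_; toℚᵘ) renaming (_+_ to _+ℚ_; _*_ to _*ℚ_; _-_ to _-ℚ_; -_ to -ℚ_)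
import Data.Rational.Properties as ℚP
open import Data.Rational.Solver using (module +-*-Solver)
open +-*-Solver using (solve; _:+_; _:*_; _:-_; _:=_)
open import Data.Rational.Unnormalised using (mkℚᵘ; *≡*) renaming (_*_ to _*ᵘ_; _+_ to _+ᵘ_; -_ to -ᵘ_; _≃_ to _≃ᵘ_)
import Data.Rational.Unnormalised.Properties as ℚᵘP

-- Multiplying by 3ᵖ clears all denominators:
--   A = 3ᵖ·4ᵖ(1/6)ₚ = ∏_{k<p} (2 + 12k),   B = 3ᵖ(2/3)ₚ = ∏_{k<p} (2 + 3k),
-- and since p ∤ 3ᵖ it suffices to show p³ ∣ A − B.
--
-- With d k = 1 + 3k, the duplication formula (1/3)₂ₚ = 4ᵖ(1/6)ₚ(2/3)ₚ reads
-- A·B = D·E with D = ∏_{k<p} d k and E = ∏_{k<p} d⁺ k, d⁺ k = d k + 3p, and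
-- reflecting k ↦ p − 1 − k gives B = ∏_{k<p} d⁻ k, d⁻ k = 3p − d k.  In each
-- product only the centre factor k = 2q is divisible by p (it is p, 4p, 2p);
-- the remaining product W splits into mirror pairs (x, y) with
-- d x + d y ∈ {2p, 5p}.  Shifting both members of such a pair by ±3p changes
-- their product only modulo p², so W d⁺ ≡ W d ≡ W d⁻ (mod p²), while p ∤ W d.
-- Dividing A·B = D·E by 2p² gives W d⁻·(A − B) = 2p (W d·W d⁺ − (W d⁻)²),
-- which is ≡ 0 (mod p³); as p ∤ W d⁻, p³ ∣ A − B.

-- Congruence of integers modulo a natural number, as a record so that the
-- compared integers stay visible to unification.
infix 4 _≡ᶻ_[mod_]
record _≡ᶻ_[mod_] (x y : ℤ) (m : ℕ) : Set where
  constructor congruent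
  field m∣x-y : + m ∣ᶻ x -ᶻ y
open _≡ᶻ_[mod_]

≡ᶻ-refl : ∀ {m} x → x ≡ᶻ x [mod m ]
≡ᶻ-refl x = congruent (divides (+ 0) (ℤP.+-inverseʳ x))

≡ᶻ-sym : ∀ {m x y} → x ≡ᶻ y [mod m ] → y ≡ᶻ x [mod m ]
≡ᶻ-sym {m} {x} {y} (congruent m∣x-y) =
  congruent (subst (+ m ∣ᶻ_) (negated x y) (ℤ∣.∣m⇒∣-m m∣x-y))
  where
  negated : ∀ x y → -ᶻ (x -ᶻ y) ≡ y -ᶻ x
  negated = solve-∀

≡ᶻ-trans : ∀ {m x y z} → x ≡ᶻ y [mod m ] → y ≡ᶻ z [mod m ] → x ≡ᶻ z [mod m ]
≡ᶻ-trans {m} {x} {y} {z} (congruent m∣x-y) (congruent m∣y-z) =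
  congruent (subst (+ m ∣ᶻ_) (telescope x y z) (ℤ∣.∣m∣n⇒∣m+n m∣x-y m∣y-z))
  where
  telescope : ∀ x y z → (x -ᶻ y) +ᶻ (y -ᶻ z) ≡ x -ᶻ z
  telescope = solve-∀

≡ᶻ-*-cong : ∀ {m x y u v} → x ≡ᶻ y [mod m ] → u ≡ᶻ v [mod m ] → x *ᶻ u ≡ᶻ y *ᶻ v [mod m ]
≡ᶻ-*-cong {m} {x} {y} {u} {v} (congruent m∣x-y) (congruent m∣u-v) =
  congruent (subst (+ m ∣ᶻ_) (expand x y u v)
    (ℤ∣.∣m∣n⇒∣m+n (ℤ∣.∣m⇒∣m*n u m∣x-y) (ℤ∣.∣n⇒∣m*n y m∣u-v)))
  where
  expand : ∀ x y u v → (x -ᶻ y) *ᶻ u +ᶻ y *ᶻ (u -ᶻ v) ≡ x *ᶻ u -ᶻ y *ᶻ v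
  expand = solve-∀

∣-*-∣ : ∀ {a b x y} → + a ∣ᶻ x → + b ∣ᶻ y → + (a * b) ∣ᶻ x *ᶻ y
∣-*-∣ {a} {b} (divides s refl) (divides t refl) =
  divides (s *ᶻ t) (trans (regroup s (+ a) t (+ b)) (cong (s *ᶻ t *ᶻ_) (sym (ℤP.pos-* a b))))
  where
  regroup : ∀ s a t b → s *ᶻ a *ᶻ (t *ᶻ b) ≡ s *ᶻ t *ᶻ (a *ᶻ b)
  regroup = solve-∀

euclidᶻ : ∀ {p} x y → Prime p → + p ∣ᶻ x *ᶻ y → + p ∣ᶻ x ⊎ + p ∣ᶻ y
euclidᶻ x y pr p∣xy with euclidsLemma ∣ x ∣ ∣ y ∣ pr (subst (_ ∣_) (ℤP.abs-* x y) (ℤ∣.∣⇒∣ᵤ p∣xy))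
... | inj₁ p∣x = inj₁ (ℤ∣.∣ᵤ⇒∣ p∣x)
... | inj₂ p∣y = inj₂ (ℤ∣.∣ᵤ⇒∣ p∣y)

prime-coprime : ∀ {p n} → Prime p → ¬ p ∣ n → Coprime p n
prime-coprime pr p∤n (i∣p , i∣n) with prime⇒irreducible pr i∣p
... | inj₁ i≡1    = i≡1
... | inj₂ refl   = ⊥-elim (p∤n i∣n)

coprime-*ˡ : ∀ {a b c} → Coprime a c → Coprime b c → Coprime (a * b) c
coprime-*ˡ {a} {b} {c} a⊥c b⊥c {i} (i∣ab , i∣c) =
  a⊥c (coprime-divisor i⊥b (subst (i ∣_) (ℕ.*-comm a b) i∣ab) , i∣c)
  where
  i⊥b : Coprime i b
  i⊥b (j∣i , j∣b) = b⊥c (j∣b , ∣-trans j∣i i∣c)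

coprime-^ˡ : ∀ {a c} n → Coprime a c → Coprime (a ^ n) c
coprime-^ˡ zero    a⊥c (i∣1 , _) = ∣1⇒≡1 i∣1
coprime-^ˡ (suc n) a⊥c = coprime-*ˡ a⊥c (coprime-^ˡ n a⊥c)

∏ : (ℕ → ℤ) → ℕ → ℕ → ℤ
∏ f a zero    = + 1
∏ f a (suc n) = ∏ f a n *ᶻ f (a + n)

∏-split : ∀ f a m n → ∏ f a (m + n) ≡ ∏ f a m *ᶻ ∏ f (a + m) n
∏-split f a m zero    rewrite ℕ.+-identityʳ m = sym (ℤP.*-identityʳ (∏ f a m))
∏-split f a m (suc n) rewrite ℕ.+-suc m n | ∏-split f a m n | ℕ.+-assoc a m n =
  ℤP.*-assoc (∏ f a m) (∏ f (a + m) n) (f (a + (m + n)))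

∏-front : ∀ f a n → ∏ f a (suc n) ≡ f a *ᶻ ∏ f (suc a) n
∏-front f a n = begin
  ∏ f a (1 + n)                     ≡⟨ ∏-split f a 1 n ⟩
  + 1 *ᶻ f (a + 0) *ᶻ ∏ f (a + 1) n
    ≡⟨ cong₂ (λ u b → u *ᶻ ∏ f b n) (ℤP.*-identityˡ (f (a + 0))) (ℕ.+-comm a 1) ⟩
  f (a + 0) *ᶻ ∏ f (suc a) n        ≡⟨ cong (λ b → f b *ᶻ ∏ f (suc a) n) (ℕ.+-identityʳ a) ⟩
  f a *ᶻ ∏ f (suc a) n              ∎
  where open ≡-Reasoning

∏-reindex : ∀ {f g a b} → (∀ k → f (a + k) ≡ g (b + k)) → ∀ n → ∏ f a n ≡ ∏ g b n
∏-reindex f≗g zero    = refl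
∏-reindex f≗g (suc n) = cong₂ _*ᶻ_ (∏-reindex f≗g n) (f≗g n)

-- Removing the outer pair (a + n, b) from mirror windows [a, a+n+1) and
-- [b, b+n+1) leaves mirror windows [a, a+n) and [b+1, b+1+n).
mirror-inner : ∀ {S} a b n → a + (b + suc n) ≡ suc S → a + (suc b + n) ≡ suc S
mirror-inner a b n = trans (shift a b n)
  where
  shift : ∀ a b n → a + (suc b + n) ≡ a + (b + suc n)
  shift = ℕS.solve-∀

mirror-outer : ∀ {S} a b n → a + (b + suc n) ≡ suc S → a + n + b ≡ S
mirror-outer a b n e = ℕ.suc-injective (trans (outer a b n) e)
  where
  outer : ∀ a b n → suc (a + n + b) ≡ a + (b + suc n)
  outer = ℕS.solve-∀

∏-reflect : ∀ {f g S} → (∀ x y → x + y ≡ S → f x ≡ g y) →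
  ∀ n a b → a + (b + n) ≡ suc S → ∏ f a n ≡ ∏ g b n
∏-reflect f~g zero    a b e = refl
∏-reflect {f} {g} f~g (suc n) a b e = begin
  ∏ f a n *ᶻ f (a + n)  ≡⟨ cong₂ _*ᶻ_ (∏-reflect f~g n a (suc b) (mirror-inner a b n e))
                                      (f~g (a + n) b (mirror-outer a b n e)) ⟩
  ∏ g (suc b) n *ᶻ g b  ≡⟨ ℤP.*-comm (∏ g (suc b) n) (g b) ⟩
  g b *ᶻ ∏ g (suc b) n  ≡⟨ ∏-front g b n ⟨
  ∏ g b (suc n)         ∎
  where open ≡-Reasoning

∏-mirror-cong : ∀ {f g S m} → (∀ x y → x + y ≡ S → f x *ᶻ f y ≡ᶻ g x *ᶻ g y [mod m ]) →
  ∀ n a b → a + (b + n) ≡ suc S → ∏ f a n *ᶻ ∏ f b n ≡ᶻ ∏ g a n *ᶻ ∏ g b n [mod m ]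
∏-mirror-cong f~g zero    a b e = ≡ᶻ-refl (+ 1)
∏-mirror-cong {f} {g} {m = m} f~g (suc n) a b e =
  subst₂ (_≡ᶻ_[mod m ]) (sym (outer-pair f)) (sym (outer-pair g))
    (≡ᶻ-*-cong (∏-mirror-cong {f} {g} f~g n a (suc b) (mirror-inner a b n e))
               (f~g (a + n) b (mirror-outer a b n e)))
  where
  regroup : ∀ u x y v → u *ᶻ x *ᶻ (y *ᶻ v) ≡ u *ᶻ v *ᶻ (x *ᶻ y)
  regroup = solve-∀
  outer-pair : ∀ h → ∏ h a (suc n) *ᶻ ∏ h b (suc n) ≡ ∏ h a n *ᶻ ∏ h (suc b) n *ᶻ (h (a + n) *ᶻ h b)
  outer-pair h = trans (cong (∏ h a (suc n) *ᶻ_) (∏-front h b n))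
                       (regroup (∏ h a n) (h (a + n)) (h b) (∏ h (suc b) n))

∏-duplication : ∀ {f g h} → (∀ k → f (k + k) *ᶻ f (suc (k + k)) ≡ g k *ᶻ h k) →
  ∀ n → ∏ f 0 (n + n) ≡ ∏ g 0 n *ᶻ ∏ h 0 n
∏-duplication f~gh zero    = refl
∏-duplication {f} {g} {h} f~gh (suc n) = begin
  ∏ f 0 (suc n + suc n)                        ≡⟨ cong (∏ f 0 ∘ suc) (ℕ.+-suc n n) ⟩
  ∏ f 0 (n + n) *ᶻ f (n + n) *ᶻ f (suc (n + n)) ≡⟨ ℤP.*-assoc (∏ f 0 (n + n)) _ _ ⟩
  ∏ f 0 (n + n) *ᶻ (f (n + n) *ᶻ f (suc (n + n))) ≡⟨ cong₂ _*ᶻ_ (∏-duplication f~gh n) (f~gh n) ⟩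
  ∏ g 0 n *ᶻ ∏ h 0 n *ᶻ (g n *ᶻ h n)            ≡⟨ regroup (∏ g 0 n) (∏ h 0 n) (g n) (h n) ⟩
  ∏ g 0 (suc n) *ᶻ ∏ h 0 (suc n)               ∎
  where
  open ≡-Reasoning
  regroup : ∀ u v x y → u *ᶻ v *ᶻ (x *ᶻ y) ≡ u *ᶻ x *ᶻ (v *ᶻ y)
  regroup = solve-∀

∏-indivisible : ∀ {p f a} → Prime p → ∀ n → (∀ i → i < n → ¬ + p ∣ᶻ f (a + i)) → ¬ + p ∣ᶻ ∏ f a n
∏-indivisible {p} pr zero _ p∣1 =
  ℕ.<⇒≢ (nonTrivial⇒n>1 p {{prime⇒nonTrivial pr}}) (sym (∣1⇒≡1 (ℤ∣.∣⇒∣ᵤ p∣1)))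
∏-indivisible {f = f} {a} pr (suc n) p∤f p∣∏ with euclidᶻ (∏ f a n) (f (a + n)) pr p∣∏
... | inj₁ p∣∏′ = ∏-indivisible pr n (λ i i<n → p∤f i (ℕ.m<n⇒m<1+n i<n)) p∣∏′
... | inj₂ p∣f  = p∤f n ℕ.≤-refl p∣f

-- For p = 6q+1: the product of f over [0, p) with the centre index 2q removed.
-- Its factors pair up into mirror pairs with index sums 4q and 10q+1.
W : ℕ → (ℕ → ℤ) → ℤ
W q f = ∏ f 0 (2 * q) *ᶻ ∏ f (1 + 2 * q) (4 * q)

∏-centre : ∀ q f → ∏ f 0 (6 * q + 1) ≡ f (2 * q) *ᶻ W q f
∏-centre q f = begin
  ∏ f 0 (6 * q + 1)                                   ≡⟨ cong (∏ f 0) (around-centre q) ⟩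
  ∏ f 0 (2 * q + suc (4 * q))                         ≡⟨ ∏-split f 0 (2 * q) (suc (4 * q)) ⟩
  ∏ f 0 (2 * q) *ᶻ ∏ f (2 * q) (suc (4 * q))           ≡⟨ cong (∏ f 0 (2 * q) *ᶻ_) (∏-front f (2 * q) (4 * q)) ⟩
  ∏ f 0 (2 * q) *ᶻ (f (2 * q) *ᶻ ∏ f (1 + 2 * q) (4 * q)) ≡⟨ swap (∏ f 0 (2 * q)) (f (2 * q)) _ ⟩
  f (2 * q) *ᶻ W q f                                  ∎
  where
  open ≡-Reasoning
  around-centre : ∀ q → 6 * q + 1 ≡ 2 * q + suc (4 * q)
  around-centre = ℕS.solve-∀
  swap : ∀ x y z → x *ᶻ (y *ᶻ z) ≡ y *ᶻ (x *ᶻ z)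
  swap = solve-∀

W-mirror-windows : ∀ q f → W q f ≡
  (∏ f 0 (2 * q) *ᶻ ∏ f (1 + 2 * q) (2 * q)) *ᶻ (∏ f (1 + 4 * q) q *ᶻ ∏ f (1 + 5 * q) q)
W-mirror-windows q f = begin
  ∏ f 0 (2 * q) *ᶻ ∏ f (1 + 2 * q) (4 * q)
    ≡⟨ cong (λ n → ∏ f 0 (2 * q) *ᶻ ∏ f (1 + 2 * q) n) (halves q) ⟩
  ∏ f 0 (2 * q) *ᶻ ∏ f (1 + 2 * q) (2 * q + (q + q))
    ≡⟨ cong (∏ f 0 (2 * q) *ᶻ_) (∏-split f (1 + 2 * q) (2 * q) (q + q)) ⟩
  ∏ f 0 (2 * q) *ᶻ (∏ f (1 + 2 * q) (2 * q) *ᶻ ∏ f (1 + 2 * q + 2 * q) (q + q))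
    ≡⟨ cong (λ r → ∏ f 0 (2 * q) *ᶻ (∏ f (1 + 2 * q) (2 * q) *ᶻ r)) (∏-split f (1 + 2 * q + 2 * q) q q) ⟩
  ∏ f 0 (2 * q) *ᶻ (∏ f (1 + 2 * q) (2 * q) *ᶻ (∏ f (1 + 2 * q + 2 * q) q *ᶻ ∏ f (1 + 2 * q + 2 * q + q) q))
    ≡⟨ cong₂ (λ b c → ∏ f 0 (2 * q) *ᶻ (∏ f (1 + 2 * q) (2 * q) *ᶻ (∏ f b q *ᶻ ∏ f c q))) (third q) (fourth q) ⟩
  ∏ f 0 (2 * q) *ᶻ (∏ f (1 + 2 * q) (2 * q) *ᶻ (∏ f (1 + 4 * q) q *ᶻ ∏ f (1 + 5 * q) q))
    ≡⟨ ℤP.*-assoc (∏ f 0 (2 * q)) _ _ ⟨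
  (∏ f 0 (2 * q) *ᶻ ∏ f (1 + 2 * q) (2 * q)) *ᶻ (∏ f (1 + 4 * q) q *ᶻ ∏ f (1 + 5 * q) q) ∎
  where
  open ≡-Reasoning
  halves : ∀ q → 4 * q ≡ 2 * q + (q + q)
  halves = ℕS.solve-∀
  third : ∀ q → 1 + 2 * q + 2 * q ≡ 1 + 4 * q
  third = ℕS.solve-∀
  fourth : ∀ q → 1 + 2 * q + 2 * q + q ≡ 1 + 5 * q
  fourth = ℕS.solve-∀

Mirror : ℕ → ℕ → ℕ → Set
Mirror q x y = x + y ≡ 4 * q ⊎ x + y ≡ 10 * q + 1

W-cong : ∀ {q f g m} → (∀ x y → Mirror q x y → f x *ᶻ f y ≡ᶻ g x *ᶻ g y [mod m ]) →
  W q f ≡ᶻ W q g [mod m ]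
W-cong {q} {f} {g} {m} pairs-cong =
  subst₂ (_≡ᶻ_[mod m ]) (sym (W-mirror-windows q f)) (sym (W-mirror-windows q g))
    (≡ᶻ-*-cong (∏-mirror-cong {f} {g} (λ x y e → pairs-cong x y (inj₁ e)) (2 * q) 0 (1 + 2 * q) (inner q))
               (∏-mirror-cong {f} {g} (λ x y e → pairs-cong x y (inj₂ e)) q (1 + 4 * q) (1 + 5 * q) (outer q)))
  where
  inner : ∀ q → 1 + 2 * q + 2 * q ≡ suc (4 * q)
  inner = ℕS.solve-∀
  outer : ∀ q → 1 + 4 * q + (1 + 5 * q + q) ≡ suc (10 * q + 1)
  outer = ℕS.solve-∀

W-indivisible : ∀ {p q f} → Prime p → (∀ k → k < 6 * q + 1 → k ≢ 2 * q → ¬ + p ∣ᶻ f k) → ¬ + p ∣ᶻ W q f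
W-indivisible {p} {q} {f} pr p∤f p∣W with euclidᶻ (∏ f 0 (2 * q)) (∏ f (1 + 2 * q) (4 * q)) pr p∣W
... | inj₁ p∣left  = ∏-indivisible pr (2 * q) left p∣left
  where
  left : ∀ i → i < 2 * q → ¬ + p ∣ᶻ f i
  left i i<2q =
    p∤f i (ℕ.<-≤-trans i<2q (ℕ.≤-trans (ℕ.m≤m+n (2 * q) (4 * q + 1)) (ℕ.≤-reflexive (split q))))
          (ℕ.<⇒≢ i<2q)
    where
    split : ∀ q → 2 * q + (4 * q + 1) ≡ 6 * q + 1
    split = ℕS.solve-∀
... | inj₂ p∣right = ∏-indivisible pr (4 * q) right p∣right
  where
  right : ∀ i → i < 4 * q → ¬ + p ∣ᶻ f (1 + 2 * q + i)
  right i i<4q =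
    p∤f (1 + 2 * q + i) (ℕ.<-≤-trans (ℕ.+-monoʳ-< (1 + 2 * q) i<4q) (ℕ.≤-reflexive (split q)))
                        (≢-sym (ℕ.<⇒≢ (ℕ.m≤m+n (1 + 2 * q) i)))
    where
    split : ∀ q → 1 + 2 * q + 4 * q ≡ 6 * q + 1
    split = ℕS.solve-∀

-- Shifting both members of a pair with sum ≡ 0 (mod m) by a multiple t of m
-- leaves their product unchanged modulo m²:  (x+t)(y+t) = xy + t(x+y+t).
shifted-pair : ∀ {m t} x y → + m ∣ᶻ x +ᶻ y → + m ∣ᶻ t → (x +ᶻ t) *ᶻ (y +ᶻ t) ≡ᶻ x *ᶻ y [mod m * m ]
shifted-pair {m} {t} x y m∣x+y m∣t =
  congruent (subst (+ (m * m) ∣ᶻ_) (sym (expand x y t)) (∣-*-∣ (ℤ∣.∣m∣n⇒∣m+n m∣x+y m∣t) m∣t))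
  where
  expand : ∀ x y t → (x +ᶻ t) *ᶻ (y +ᶻ t) -ᶻ x *ᶻ y ≡ (x +ᶻ y +ᶻ t) *ᶻ t
  expand = solve-∀

W-shift-cong : ∀ {q m f t} → (∀ x y → Mirror q x y → + m ∣ᶻ f x +ᶻ f y) → + m ∣ᶻ t →
  W q (λ k → f k +ᶻ t) ≡ᶻ W q f [mod m * m ]
W-shift-cong {q} {m} {f} {t} m∣pairs m∣t =
  W-cong {q} {λ k → f k +ᶻ t} {f} (λ x y mirror → shifted-pair (f x) (f y) (m∣pairs x y mirror) m∣t)

W-reflect-cong : ∀ {q m f t} → (∀ x y → Mirror q x y → + m ∣ᶻ f x +ᶻ f y) → + m ∣ᶻ t →
  W q (λ k → t -ᶻ f k) ≡ᶻ W q f [mod m * m ]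
W-reflect-cong {q} {m} {f} {t} m∣pairs m∣t = W-cong {q} {λ k → t -ᶻ f k} {f} reflected-pair
  where
  reflect : ∀ x y t → (t -ᶻ x) *ᶻ (t -ᶻ y) ≡ (x +ᶻ -ᶻ t) *ᶻ (y +ᶻ -ᶻ t)
  reflect = solve-∀
  reflected-pair : ∀ x y → Mirror q x y → (t -ᶻ f x) *ᶻ (t -ᶻ f y) ≡ᶻ f x *ᶻ f y [mod m * m ]
  reflected-pair x y mirror = subst (_≡ᶻ f x *ᶻ f y [mod m * m ]) (sym (reflect (f x) (f y) t))
    (shifted-pair (f x) (f y) (m∣pairs x y mirror) (ℤ∣.∣m⇒∣-m m∣t))

-- The arithmetic progression 1, 4, 7, ... whose products build (1/3)_n.
d : ℕ → ℤ
d k = + (1 + 3 * k)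

d-centre : ∀ q → d (2 * q) ≡ + (6 * q + 1)
d-centre q = cong +_ (centre q)
  where
  centre : ∀ q → 1 + 3 * (2 * q) ≡ 6 * q + 1
  centre = ℕS.solve-∀

d-mirror-sum : ∀ {q} x y → Mirror q x y → + (6 * q + 1) ∣ᶻ d x +ᶻ d y
d-mirror-sum {q} x y mirror = subst (+ (6 * q + 1) ∣ᶻ_) (sym sum) (pair-sum mirror)
  where
  sum : d x +ᶻ d y ≡ + (2 + 3 * (x + y))
  sum = trans (sym (ℤP.pos-+ (1 + 3 * x) (1 + 3 * y))) (cong +_ (sum-formula x y))
    where
    sum-formula : ∀ x y → 1 + 3 * x + (1 + 3 * y) ≡ 2 + 3 * (x + y)
    sum-formula = ℕS.solve-∀
  multiple : ∀ c {s} → 2 + 3 * s ≡ c * (6 * q + 1) → + (6 * q + 1) ∣ᶻ + (2 + 3 * s)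
  multiple c e = divides (+ c) (trans (cong +_ e) (ℤP.pos-* c (6 * q + 1)))
  pair-sum : Mirror q x y → + (6 * q + 1) ∣ᶻ + (2 + 3 * (x + y))
  pair-sum (inj₁ e) = subst (λ s → + (6 * q + 1) ∣ᶻ + (2 + 3 * s)) (sym e) (multiple 2 {4 * q} (twice q))
    where
    twice : ∀ q → 2 + 3 * (4 * q) ≡ 2 * (6 * q + 1)
    twice = ℕS.solve-∀
  pair-sum (inj₂ e) =
    subst (λ s → + (6 * q + 1) ∣ᶻ + (2 + 3 * s)) (sym e) (multiple 5 {10 * q + 1} (five-times q))
    where
    five-times : ∀ q → 2 + 3 * (10 * q + 1) ≡ 5 * (6 * q + 1)
    five-times = ℕS.solve-∀

-- ... and it is the only term among the first p divisible by p: if p ∣ 1 + 3k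
-- with k < p, the cofactor c satisfies c < 4 and c ≡ 1 (mod 3), so c = 1.
centre-index : ∀ q k → k < 6 * q + 1 → (6 * q + 1) ∣ 1 + 3 * k → k ≡ 2 * q
centre-index q k k<p (divides c 1+3k≡cp) =
  ℕ.*-cancelˡ-≡ k (2 * q) 3 (ℕ.suc-injective (trans 1+3k≡cp (trans (cong (_* p) c≡1) (unit-multiple q))))
  where
  p : ℕ
  p = 6 * q + 1
  unit-multiple : ∀ q → 1 * (6 * q + 1) ≡ 1 + 3 * (2 * q)
  unit-multiple = ℕS.solve-∀
  below-4p : 1 + 3 * k < 4 * p
  below-4p = ℕ.<-≤-trans (s≤s (ℕ.*-monoʳ-< 3 k<p))
               (ℕ.≤-trans (ℕ.+-monoˡ-≤ (3 * p) (ℕ.m≤n+m 1 (6 * q))) (ℕ.≤-reflexive (four-times p)))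
    where
    four-times : ∀ p → p + 3 * p ≡ 4 * p
    four-times = ℕS.solve-∀
  c<4 : c < 4
  c<4 = ℕ.*-cancelʳ-< p c 4 (subst (_< 4 * p) 1+3k≡cp below-4p)
  c%3≡1 : c % 3 ≡ 1
  c%3≡1 = begin
    c % 3                     ≡⟨ [m+kn]%n≡m%n c (2 * q * c) 3 ⟨
    (c + 2 * q * c * 3) % 3   ≡⟨ cong (_% 3) (regroup c q) ⟩
    (c * p) % 3               ≡⟨ cong (_% 3) 1+3k≡cp ⟨
    (1 + 3 * k) % 3           ≡⟨ cong (_% 3) (cong suc (ℕ.*-comm 3 k)) ⟩
    (1 + k * 3) % 3           ≡⟨ [m+kn]%n≡m%n 1 k 3 ⟩
    1                         ∎
    where
    open ≡-Reasoning
    regroup : ∀ c q → c + 2 * q * c * 3 ≡ c * (6 * q + 1)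
    regroup = ℕS.solve-∀
  c≡1 : c ≡ 1
  c≡1 = only-unit c c<4 c%3≡1
    where
    only-unit : ∀ c → c < 4 → c % 3 ≡ 1 → c ≡ 1
    only-unit 1 _ _ = refl
    only-unit 0 _ ()
    only-unit 2 _ ()
    only-unit 3 _ ()
    only-unit (suc (suc (suc (suc _)))) (s≤s (s≤s (s≤s (s≤s ())))) _

d-indivisible : ∀ q k → k < 6 * q + 1 → k ≢ 2 * q → ¬ + (6 * q + 1) ∣ᶻ d k
d-indivisible q k k<p k≢2q p∣dk = k≢2q (centre-index q k k<p (ℤ∣.∣⇒∣ᵤ p∣dk))

-- Dividing the duplication identity A·B = D·E by p: writing D = p·Wd,
-- E = 4p·We and B = 2p·Wg (T = 3p), we get Wg (A - B) = 2p (Wd We - Wg²),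
-- so Wd We ≡ Wg² (mod p²) gives p³ ∣ Wg (A - B).
cube-divides : ∀ {p} .{{_ : NonZero p}} (A B Wd We Wg : ℤ) →
  A *ᶻ B ≡ (+ p *ᶻ Wd) *ᶻ ((+ p +ᶻ + 3 *ᶻ + p) *ᶻ We) →
  B ≡ (+ 3 *ᶻ + p -ᶻ + p) *ᶻ Wg →
  Wd *ᶻ We ≡ᶻ Wg *ᶻ Wg [mod p * p ] →
  + (p * (p * p)) ∣ᶻ Wg *ᶻ (A -ᶻ B)
cube-divides {p} A B Wd We Wg AB≡DE B≡2pWg (congruent p²∣Δ) =
  subst (+ (p * (p * p)) ∣ᶻ_) (sym factored) (ℤ∣.∣n⇒∣m*n (+ 2) (∣-*-∣ (ℤ∣.∣-refl {+ p}) p²∣Δ))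
  where
  P : ℤ
  P = + p
  open ≡-Reasoning
  scaled : + 2 *ᶻ (P *ᶻ (A *ᶻ Wg)) ≡ + 2 *ᶻ (P *ᶻ (+ 2 *ᶻ P *ᶻ (Wd *ᶻ We)))
  scaled = begin
    + 2 *ᶻ (P *ᶻ (A *ᶻ Wg))                    ≡⟨ extract-B A Wg P ⟩
    A *ᶻ ((+ 3 *ᶻ P -ᶻ P) *ᶻ Wg)               ≡⟨ cong (A *ᶻ_) B≡2pWg ⟨
    A *ᶻ B                                    ≡⟨ AB≡DE ⟩
    (P *ᶻ Wd) *ᶻ ((P +ᶻ + 3 *ᶻ P) *ᶻ We)        ≡⟨ expand-DE Wd We P ⟩
    + 2 *ᶻ (P *ᶻ (+ 2 *ᶻ P *ᶻ (Wd *ᶻ We)))     ∎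
    where
    extract-B : ∀ A Wg P → + 2 *ᶻ (P *ᶻ (A *ᶻ Wg)) ≡ A *ᶻ ((+ 3 *ᶻ P -ᶻ P) *ᶻ Wg)
    extract-B = solve-∀
    expand-DE : ∀ Wd We P → (P *ᶻ Wd) *ᶻ ((P +ᶻ + 3 *ᶻ P) *ᶻ We) ≡ + 2 *ᶻ (P *ᶻ (+ 2 *ᶻ P *ᶻ (Wd *ᶻ We)))
    expand-DE = solve-∀
  AWg≡2pWdWe : A *ᶻ Wg ≡ + 2 *ᶻ P *ᶻ (Wd *ᶻ We)
  AWg≡2pWdWe = ℤP.*-cancelˡ-≡ P _ _ (ℤP.*-cancelˡ-≡ (+ 2) _ _ scaled)
  factored : Wg *ᶻ (A -ᶻ B) ≡ + 2 *ᶻ (P *ᶻ (Wd *ᶻ We -ᶻ Wg *ᶻ Wg))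
  factored = begin
    Wg *ᶻ (A -ᶻ B)                                   ≡⟨ cong (λ b → Wg *ᶻ (A -ᶻ b)) B≡2pWg ⟩
    Wg *ᶻ (A -ᶻ (+ 3 *ᶻ P -ᶻ P) *ᶻ Wg)                ≡⟨ distribute Wg A P ⟩
    A *ᶻ Wg -ᶻ + 2 *ᶻ P *ᶻ (Wg *ᶻ Wg)                 ≡⟨ cong (_-ᶻ + 2 *ᶻ P *ᶻ (Wg *ᶻ Wg)) AWg≡2pWdWe ⟩
    + 2 *ᶻ P *ᶻ (Wd *ᶻ We) -ᶻ + 2 *ᶻ P *ᶻ (Wg *ᶻ Wg)  ≡⟨ collect P (Wd *ᶻ We) (Wg *ᶻ Wg) ⟩
    + 2 *ᶻ (P *ᶻ (Wd *ᶻ We -ᶻ Wg *ᶻ Wg))              ∎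
    where
    distribute : ∀ Wg A P → Wg *ᶻ (A -ᶻ (+ 3 *ᶻ P -ᶻ P) *ᶻ Wg) ≡ A *ᶻ Wg -ᶻ + 2 *ᶻ P *ᶻ (Wg *ᶻ Wg)
    distribute = solve-∀
    collect : ∀ P X Y → + 2 *ᶻ P *ᶻ X -ᶻ + 2 *ᶻ P *ᶻ Y ≡ + 2 *ᶻ (P *ᶻ (X -ᶻ Y))
    collect = solve-∀

-- Factors of 12ⁿ (1/6)ₙ and of 3ⁿ (2/3)ₙ respectively.
sixths : ℕ → ℤ
sixths k = + (2 + 12 * k)

thirds : ℕ → ℤ
thirds k = + (2 + 3 * k)

-- For p = 6q+1, the shift T = 3p and the two companions of d:
-- d⁺ k = d k + 3p = d (p + k), and d⁻ k = 3p − d k = 2 + 3(p − 1 − k).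
T : ℕ → ℤ
T q = + 3 *ᶻ + (6 * q + 1)

d⁺ d⁻ : ℕ → ℕ → ℤ
d⁺ q k = d k +ᶻ T q
d⁻ q k = T q -ᶻ d k

-- Duplication (1/3)₂ₚ = 4ᵖ (1/6)ₚ (2/3)ₚ cleared of denominators, with the
-- halves D = ∏_{k<p} d k and E = ∏_{k<p} d⁺ k split at their centres.
duplication-identity : ∀ q → let p = 6 * q + 1 in
  ∏ sixths 0 p *ᶻ ∏ thirds 0 p ≡ (+ p *ᶻ W q d) *ᶻ ((+ p +ᶻ T q) *ᶻ W q (d⁺ q))
duplication-identity q = begin
  ∏ sixths 0 p *ᶻ ∏ thirds 0 p ≡⟨ ∏-duplication {d} {sixths} {thirds} consecutive p ⟨
  ∏ d 0 (p + p)                ≡⟨ ∏-split d 0 p p ⟩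
  ∏ d 0 p *ᶻ ∏ d p p           ≡⟨ cong (∏ d 0 p *ᶻ_) (∏-reindex {d} {d⁺ q} shift p) ⟩
  ∏ d 0 p *ᶻ ∏ (d⁺ q) 0 p      ≡⟨ cong₂ _*ᶻ_ (∏-centre q d) (∏-centre q (d⁺ q)) ⟩
  (d (2 * q) *ᶻ W q d) *ᶻ ((d (2 * q) +ᶻ T q) *ᶻ W q (d⁺ q))
    ≡⟨ cong (λ c → (c *ᶻ W q d) *ᶻ ((c +ᶻ T q) *ᶻ W q (d⁺ q))) (d-centre q) ⟩
  (+ p *ᶻ W q d) *ᶻ ((+ p +ᶻ T q) *ᶻ W q (d⁺ q)) ∎
  where
  open ≡-Reasoning
  p : ℕ
  p = 6 * q + 1
  consecutive : ∀ k → d (k + k) *ᶻ d (suc (k + k)) ≡ sixths k *ᶻ thirds k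
  consecutive k = trans (sym (ℤP.pos-* (1 + 3 * (k + k)) (1 + 3 * suc (k + k))))
                    (trans (cong +_ (product k)) (ℤP.pos-* (2 + 12 * k) (2 + 3 * k)))
    where
    product : ∀ k → (1 + 3 * (k + k)) * (1 + 3 * suc (k + k)) ≡ (2 + 12 * k) * (2 + 3 * k)
    product = ℕS.solve-∀
  shift : ∀ k → d (p + k) ≡ d⁺ q k
  shift k = trans (cong +_ (shifted p k)) (trans (ℤP.pos-+ (1 + 3 * k) (3 * p)) (cong (d k +ᶻ_) (ℤP.pos-* 3 p)))
    where
    shifted : ∀ p k → 1 + 3 * (p + k) ≡ 1 + 3 * k + 3 * p
    shifted = ℕS.solve-∀

-- Reflecting k ↦ p − 1 − k turns the factors of 3ᵖ (2/3)ₚ into those of d⁻.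
thirds-reflected : ∀ q → let p = 6 * q + 1 in ∏ thirds 0 p ≡ (T q -ᶻ + p) *ᶻ W q (d⁻ q)
thirds-reflected q = begin
  ∏ thirds 0 p                  ≡⟨ ∏-reflect {d⁻ q} {thirds} reflect p 0 0 (whole q) ⟨
  ∏ (d⁻ q) 0 p                  ≡⟨ ∏-centre q (d⁻ q) ⟩
  (T q -ᶻ d (2 * q)) *ᶻ W q (d⁻ q) ≡⟨ cong (λ c → (T q -ᶻ c) *ᶻ W q (d⁻ q)) (d-centre q) ⟩
  (T q -ᶻ + p) *ᶻ W q (d⁻ q)       ∎
  where
  open ≡-Reasoning
  p : ℕ
  p = 6 * q + 1
  whole : ∀ q → 0 + (0 + (6 * q + 1)) ≡ suc (6 * q)
  whole = ℕS.solve-∀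
  complement : ∀ x y → x + y ≡ 6 * q → 1 + 3 * x + (2 + 3 * y) ≡ 3 * p
  complement x y x+y≡6q = trans (sum-formula x y) (trans (cong (λ s → 3 + 3 * s) x+y≡6q) (triple q))
    where
    sum-formula : ∀ x y → 1 + 3 * x + (2 + 3 * y) ≡ 3 + 3 * (x + y)
    sum-formula = ℕS.solve-∀
    triple : ∀ q → 3 + 3 * (6 * q) ≡ 3 * (6 * q + 1)
    triple = ℕS.solve-∀
  reflect : ∀ x y → x + y ≡ 6 * q → d⁻ q x ≡ thirds y
  reflect x y x+y≡6q = begin
    + 3 *ᶻ + p -ᶻ d x                   ≡⟨ cong (_-ᶻ d x) (ℤP.pos-* 3 p) ⟨
    + (3 * p) -ᶻ d x                   ≡⟨ cong (λ c → + c -ᶻ d x) (complement x y x+y≡6q) ⟨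
    + (1 + 3 * x + (2 + 3 * y)) -ᶻ d x ≡⟨ cong (_-ᶻ d x) (ℤP.pos-+ (1 + 3 * x) (2 + 3 * y)) ⟩
    d x +ᶻ thirds y -ᶻ d x             ≡⟨ cancel (d x) (thirds y) ⟩
    thirds y                           ∎
    where
    cancel : ∀ u v → u +ᶻ v -ᶻ u ≡ v
    cancel = solve-∀

-- Both companions agree with d on W modulo p², since 3p ≡ 0 (mod p) and the
-- mirror pairs of d sum to multiples of p.
W⁺-cong : ∀ q → W q (d⁺ q) ≡ᶻ W q d [mod (6 * q + 1) * (6 * q + 1) ]
W⁺-cong q = W-shift-cong {q} {6 * q + 1} {d} {T q} (d-mirror-sum {q}) (divides (+ 3) refl)

W⁻-cong : ∀ q → W q (d⁻ q) ≡ᶻ W q d [mod (6 * q + 1) * (6 * q + 1) ]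
W⁻-cong q = W-reflect-cong {q} {6 * q + 1} {d} {T q} (d-mirror-sum {q}) (divides (+ 3) refl)

-- p ∤ W d because W d omits the only multiple of p; hence p ∤ W d⁻ as well.
W-reflected-indivisible : ∀ q → Prime (6 * q + 1) → ¬ + (6 * q + 1) ∣ᶻ W q (d⁻ q)
W-reflected-indivisible q pr p∣W⁻ = W-indivisible {6 * q + 1} {q} {d} pr (d-indivisible q)
  (subst (+ p ∣ᶻ_) (recover (W q (d⁻ q)) (W q d))
    (ℤ∣.∣m∣n⇒∣m-n p∣W⁻ (ℤ∣.∣-trans (divides (+ p) (ℤP.pos-* p p)) (m∣x-y (W⁻-cong q)))))
  where
  p : ℕ
  p = 6 * q + 1
  recover : ∀ u v → u -ᶻ (u -ᶻ v) ≡ v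
  recover = solve-∀

progression-congruence : ∀ q → Prime (6 * q + 1) →
  (6 * q + 1) ^ 3 ∣ ∣ ∏ sixths 0 (6 * q + 1) -ᶻ ∏ thirds 0 (6 * q + 1) ∣
progression-congruence q pr =
  coprime-divisor (coprime-^ˡ 3 (prime-coprime pr (W-reflected-indivisible q pr ∘ ℤ∣.∣ᵤ⇒∣)))
    (subst₂ _∣_ cube (ℤP.abs-* W⁻ (A -ᶻ B)) (ℤ∣.∣⇒∣ᵤ p³∣W⁻[A-B]))
  where
  p : ℕ
  p = 6 * q + 1
  instance
    p≢0 : NonZero p
    p≢0 = prime⇒nonZero pr
  A B W⁻ : ℤ
  A = ∏ sixths 0 p
  B = ∏ thirds 0 p
  W⁻ = W q (d⁻ q)
  cube : p * (p * p) ≡ p ^ 3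
  cube = cong (λ c → p * (p * c)) (sym (ℕ.*-identityʳ p))
  WdW⁺≡W⁻² : W q d *ᶻ W q (d⁺ q) ≡ᶻ W⁻ *ᶻ W⁻ [mod p * p ]
  WdW⁺≡W⁻² = ≡ᶻ-trans (≡ᶻ-*-cong (≡ᶻ-refl (W q d)) (W⁺-cong q))
                      (≡ᶻ-*-cong (≡ᶻ-sym (W⁻-cong q)) (≡ᶻ-sym (W⁻-cong q)))
  p³∣W⁻[A-B] : + (p * (p * p)) ∣ᶻ W⁻ *ᶻ (A -ᶻ B)
  p³∣W⁻[A-B] = cube-divides {p} A B (W q d) (W q (d⁺ q)) W⁻
                 (duplication-identity q) (thirds-reflected q) WdW⁺≡W⁻²

ι : ℤ → ℚ
ι z = z / 1

ι-mkℚ : ∀ z → ι z ≡ mkℚ z 0 (ℕC.sym (1-coprimeTo ∣ z ∣))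
ι-mkℚ (+ n)    = ℚP.normalize-coprime {n} {0} _
ι-mkℚ -[1+ n ] = cong -ℚ_ (ℚP.normalize-coprime {suc n} {0} _)

ι-+ : ∀ z w → ι (z +ᶻ w) ≡ ι z +ℚ ι w
ι-+ z w = trans (cong ι (sym (cong₂ _+ᶻ_ (ℤP.*-identityʳ z) (ℤP.*-identityʳ w))))
  (sym (cong₂ _+ℚ_ (ι-mkℚ z) (ι-mkℚ w)))

ι-* : ∀ z w → ι (z *ᶻ w) ≡ ι z *ℚ ι w
ι-* z w = sym (cong₂ _*ℚ_ (ι-mkℚ z) (ι-mkℚ w))

ℕtoℚ-+ : ∀ m n → ℕtoℚ (m + n) ≡ ℕtoℚ m +ℚ ℕtoℚ n
ℕtoℚ-+ m n = trans (cong ι (ℤP.pos-+ m n)) (ι-+ (+ m) (+ n))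

ℕtoℚ-* : ∀ m n → ℕtoℚ (m * n) ≡ ℕtoℚ m *ℚ ℕtoℚ n
ℕtoℚ-* m n = trans (cong ι (ℤP.pos-* m n)) (ι-* (+ m) (+ n))

poch-scaled : ∀ {a r s} → a *ℚ ℕtoℚ s ≡ ℕtoℚ r → ∀ n →
  poch a n *ℚ ℕtoℚ (s ^ n) ≡ ι (∏ (λ k → + (r + s * k)) 0 n)
poch-scaled as≡r zero = refl
poch-scaled {a} {r} {s} as≡r (suc n) = begin
  poch a n *ℚ (a +ℚ ℕtoℚ n) *ℚ ℕtoℚ (s * s ^ n)
    ≡⟨ cong (poch a n *ℚ (a +ℚ ℕtoℚ n) *ℚ_) (ℕtoℚ-* s (s ^ n)) ⟩
  poch a n *ℚ (a +ℚ ℕtoℚ n) *ℚ (ℕtoℚ s *ℚ ℕtoℚ (s ^ n))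
    ≡⟨ regroup (poch a n) a (ℕtoℚ n) (ℕtoℚ s) (ℕtoℚ (s ^ n)) ⟩
  poch a n *ℚ ℕtoℚ (s ^ n) *ℚ (a *ℚ ℕtoℚ s +ℚ ℕtoℚ s *ℚ ℕtoℚ n)
    ≡⟨ cong₂ (λ u v → u *ℚ (v +ℚ ℕtoℚ s *ℚ ℕtoℚ n)) (poch-scaled as≡r n) as≡r ⟩
  ι (∏ f 0 n) *ℚ (ℕtoℚ r +ℚ ℕtoℚ s *ℚ ℕtoℚ n)
    ≡⟨ cong (λ v → ι (∏ f 0 n) *ℚ (ℕtoℚ r +ℚ v)) (ℕtoℚ-* s n) ⟨
  ι (∏ f 0 n) *ℚ (ℕtoℚ r +ℚ ℕtoℚ (s * n))
    ≡⟨ cong (ι (∏ f 0 n) *ℚ_) (ℕtoℚ-+ r (s * n)) ⟨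
  ι (∏ f 0 n) *ℚ ℕtoℚ (r + s * n)
    ≡⟨ ι-* (∏ f 0 n) (+ (r + s * n)) ⟨
  ι (∏ f 0 (suc n)) ∎
  where
  open ≡-Reasoning
  f : ℕ → ℤ
  f k = + (r + s * k)
  regroup : ∀ (P a N s S : ℚ) → P *ℚ (a +ℚ N) *ℚ (s *ℚ S) ≡ (P *ℚ S) *ℚ (a *ℚ s +ℚ s *ℚ N)
  regroup = solve 5 (λ P a N s S → P :* (a :+ N) :* (s :* S) := (P :* S) :* (a :* s :+ s :* N)) refl

numerator-relation : ∀ x c A B → x *ℚ ℕtoℚ c ≡ ι A -ℚ ι B → ↥ x *ᶻ + c ≡ (A -ᶻ B) *ᶻ ↧ x
numerator-relation x@(mkℚ _ _ _) c A B xc≡A-B with cross-multiplied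
  where
  open ℚᵘP.≃-Reasoning
  cross-multiplied : toℚᵘ x *ᵘ mkℚᵘ (+ c) 0 ≃ᵘ mkℚᵘ A 0 +ᵘ -ᵘ mkℚᵘ B 0
  cross-multiplied = begin
    toℚᵘ x *ᵘ mkℚᵘ (+ c) 0         ≡⟨ cong (λ y → toℚᵘ x *ᵘ toℚᵘ y) (ι-mkℚ (+ c)) ⟨
    toℚᵘ x *ᵘ toℚᵘ (ℕtoℚ c)        ≈⟨ ℚP.toℚᵘ-homo-* x (ℕtoℚ c) ⟨
    toℚᵘ (x *ℚ ℕtoℚ c)             ≡⟨ cong toℚᵘ xc≡A-B ⟩
    toℚᵘ (ι A -ℚ ι B)              ≈⟨ ℚP.toℚᵘ-homo-+ (ι A) (-ℚ ι B) ⟩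
    toℚᵘ (ι A) +ᵘ toℚᵘ (-ℚ ι B)    ≈⟨ ℚᵘP.+-congʳ (toℚᵘ (ι A)) (ℚP.toℚᵘ-homo‿- (ι B)) ⟩
    toℚᵘ (ι A) +ᵘ -ᵘ toℚᵘ (ι B)    ≡⟨ cong₂ (λ u v → toℚᵘ u +ᵘ -ᵘ toℚᵘ v) (ι-mkℚ A) (ι-mkℚ B) ⟩
    mkℚᵘ A 0 +ᵘ -ᵘ mkℚᵘ B 0        ∎
... | *≡* cross = trans (sym (ℤP.*-identityʳ (↥ x *ᶻ + c))) (trans cross (tidy A B (↧ x)))
  where
  tidy : ∀ A B D → (A *ᶻ + 1 +ᶻ -ᶻ B *ᶻ + 1) *ᶻ (D *ᶻ + 1) ≡ (A -ᶻ B) *ᶻ D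
  tidy = solve-∀

numerator-divisible : ∀ {m c} x A B → Coprime m c → x *ℚ ℕtoℚ c ≡ ι A -ℚ ι B →
  m ∣ ∣ A -ᶻ B ∣ → m ∣ ∣ ↥ x ∣
numerator-divisible {m} {c} x A B m⊥c xc≡A-B m∣A-B =
  coprime-divisor m⊥c (subst (m ∣_) cleared (∣m⇒∣m*n ∣ ↧ x ∣ m∣A-B))
  where
  cleared : ∣ A -ᶻ B ∣ * ∣ ↧ x ∣ ≡ c * ∣ ↥ x ∣
  cleared = begin
    ∣ A -ᶻ B ∣ * ∣ ↧ x ∣  ≡⟨ ℤP.abs-* (A -ᶻ B) (↧ x) ⟨
    ∣ (A -ᶻ B) *ᶻ ↧ x ∣   ≡⟨ cong ∣_∣ (numerator-relation x c A B xc≡A-B) ⟨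
    ∣ ↥ x *ᶻ + c ∣        ≡⟨ ℤP.abs-* (↥ x) (+ c) ⟩
    ∣ ↥ x ∣ * c           ≡⟨ ℕ.*-comm ∣ ↥ x ∣ c ⟩
    c * ∣ ↥ x ∣           ∎
    where open ≡-Reasoning

^-distribʳ-* : ∀ m n k → m ^ k * n ^ k ≡ (m * n) ^ k
^-distribʳ-* m n zero    = refl
^-distribʳ-* m n (suc k) = trans (interchange m n (m ^ k) (n ^ k)) (cong (m * n *_) (^-distribʳ-* m n k))
  where
  interchange : ∀ m n x y → m * x * (n * y) ≡ m * n * (x * y)
  interchange = ℕS.solve-∀

pochhammers-cleared : ∀ n →
  (ℕtoℚ (4 ^ n) *ℚ poch ((+ 1) / 6) n -ℚ poch ((+ 2) / 3) n) *ℚ ℕtoℚ (3 ^ n) ≡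
  ι (∏ sixths 0 n) -ℚ ι (∏ thirds 0 n)
pochhammers-cleared n = trans (distrib (ℕtoℚ (4 ^ n) *ℚ sixth) third (ℕtoℚ (3 ^ n)))
  (cong₂ _-ℚ_ scaled-sixth (poch-scaled {r = 2} {s = 3} refl n))
  where
  open ≡-Reasoning
  sixth third : ℚ
  sixth = poch ((+ 1) / 6) n
  third = poch ((+ 2) / 3) n
  distrib : ∀ (L R c : ℚ) → (L -ℚ R) *ℚ c ≡ L *ℚ c -ℚ R *ℚ c
  distrib = solve 3 (λ L R c → (L :- R) :* c := L :* c :- R :* c) refl
  regroup : ∀ (F P T : ℚ) → F *ℚ P *ℚ T ≡ P *ℚ (F *ℚ T)
  regroup = solve 3 (λ F P T → F :* P :* T := P :* (F :* T)) refl
  scaled-sixth : ℕtoℚ (4 ^ n) *ℚ sixth *ℚ ℕtoℚ (3 ^ n) ≡ ι (∏ sixths 0 n)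
  scaled-sixth = begin
    ℕtoℚ (4 ^ n) *ℚ sixth *ℚ ℕtoℚ (3 ^ n)   ≡⟨ regroup (ℕtoℚ (4 ^ n)) sixth (ℕtoℚ (3 ^ n)) ⟩
    sixth *ℚ (ℕtoℚ (4 ^ n) *ℚ ℕtoℚ (3 ^ n)) ≡⟨ cong (sixth *ℚ_) (ℕtoℚ-* (4 ^ n) (3 ^ n)) ⟨
    sixth *ℚ ℕtoℚ (4 ^ n * 3 ^ n)          ≡⟨ cong (λ k → sixth *ℚ ℕtoℚ k) (^-distribʳ-* 4 3 n) ⟩
    sixth *ℚ ℕtoℚ (12 ^ n)                 ≡⟨ poch-scaled {r = 2} {s = 12} refl n ⟩
    ι (∏ sixths 0 n)                       ∎

lemma5p1 : (q p : ℕ) → 1 ≤ q → p ≡ 6 * q + 1 → Prime p →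
    (ℕtoℚ (4 ^ p) *ℚ poch ((+ 1) / 6) p) ≡ℚ poch ((+ 2) / 3) p [mod p ^ 3 ]
lemma5p1 q .(6 * q + 1) 1≤q refl pr =
  numerator-divisible (ℕtoℚ (4 ^ p) *ℚ poch ((+ 1) / 6) p -ℚ poch ((+ 2) / 3) p)
    (∏ sixths 0 p) (∏ thirds 0 p) p³⊥3ᵖ (pochhammers-cleared p) (progression-congruence q pr)
  where
  p : ℕ
  p = 6 * q + 1
  3<p : 3 < p
  3<p = ℕ.≤-trans (s≤s (s≤s (s≤s (s≤s z≤n)))) (ℕ.≤-trans (ℕ.*-monoʳ-≤ 6 1≤q) (ℕ.m≤m+n (6 * q) 1))
  p³⊥3ᵖ : Coprime (p ^ 3) (3 ^ p)
  p³⊥3ᵖ = coprime-^ˡ 3 (ℕC.sym (coprime-^ˡ p (ℕC.sym (ℕC.prime⇒coprime pr 3<p))))
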